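{- Let $G$ be a finite directed graph and $e$ an edge of $G$ between two vertices $v_1$ and $v_2$. Then $$N(G/e)=N(G)\big|_{x_{v_1}=x_{v_2}=x_v},$$ where $v$ is the vertex of $G/e$ obtained by contracting $v_1$ and $v_2$.
   Context: A graph $G$ has a finite vertex set $V_G$ and edges $E_G$, each edge $e$ having an origin $\alpha(e)$ and an end $\omega(e)$ (for $G/e$ the edge set may be a multiset). $G/e$ is the graph obtained by contracting $e$: the vertices $v_1,v_2$ are replaced by a single vertex $v$, the edge $e$ is removed, and every other edge of $G$ is kept, with any endpoint equal to $v_1$ or $v_2$ replaced by $v$. A linear extension of $G$ is a total order on the vertices with $\alpha(f)$ before $\omega(f)$ for every edge $f$, written as the word $w=w_1\cdots w_n$ in increasing order; $\mathcal L(G)$ is their set. $\Psi(G)=\sum_{w\in\mathcal L(G)}\prod_{i=1}^{n-1}(x_{w_i}-x_{w_{i+1}})^{ -1}$ and $N(G)=\Psi(G)\prod_{f\in E_G}(x_{\alpha(f)}-x_{\omega(f)})$ (product with multiplicity); $N(G)$ is a polynomial. -}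

module Defs where

open import Data.Nat using (ℕ; zero; suc)
open import Data.Fin using (Fin; punchOut)
open import Data.Fin.Properties using () renaming (_≟_ to _≟ᶠ_)
open import Data.List using (List; []; _∷_; map; foldr; concatMap; filterᵇ; allFin; length; removeAt; lookup)
open import Data.Bool using (Bool; true; false; _∧_; if_then_else_)
open import Data.Product using (_×_; _,_; proj₁; proj₂)
open import Data.Rational using (ℚ; 0ℚ; 1ℚ; _+_; _*_; _-_; -_; 1/_; ≢-nonZero)
  renaming (_≟_ to _≟ℚ_)
open import Relation.Nullary using (yes; no; ¬_)
open import Relation.Nullary.Decidable using (⌊_⌋)
open import Relation.Binary.PropositionalEquality using (_≡_; _≢_; sym)
open import Function using (_∘_)
open import Function.Definitions using (Injective)

-- Directed multigraphs on the vertex set Fin n.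
-- An edge is a pair (origin , end); the edge set is a list (multiset).

Edge : ℕ → Set
Edge n = Fin n × Fin n

record Graph (n : ℕ) : Set where
  constructor graph
  field
    edges : List (Edge n)
open Graph public

α ω : ∀ {n} → Edge n → Fin n
α = proj₁
ω = proj₂

insertions : ∀ {A : Set} → A → List A → List (List A)
insertions a []       = (a ∷ []) ∷ []
insertions a (b ∷ bs) = (a ∷ b ∷ bs) ∷ map (b ∷_) (insertions a bs)

perms : ∀ {A : Set} → List A → List (List A)
perms []       = [] ∷ []
perms (a ∷ as) = concatMap (insertions a) (perms as)

-- `before a b w` : a occurs strictly before b in the word w
-- (false if a ≡ b, so a loop admits no linear extension).
before : ∀ {n} → Fin n → Fin n → List (Fin n) → Bool
before a b []       = false
before a b (x ∷ xs) =
  if ⌊ x ≟ᶠ b ⌋ then false else (if ⌊ x ≟ᶠ a ⌋ then true else before a b xs)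

isLinExt : ∀ {n} → Graph n → List (Fin n) → Bool
isLinExt G w = foldr (λ f acc → before (α f) (ω f) w ∧ acc) true (edges G)

linExts : ∀ {n} → Graph n → List (List (Fin n))
linExts {n} G = filterᵇ (isLinExt G) (perms (allFin n))

-- total inverse (0 at 0); only used at points where denominators are ≠ 0
inv : ℚ → ℚ
inv q with q ≟ℚ 0ℚ
... | yes _  = 0ℚ
... | no q≢0 = 1/_ q {{≢-nonZero q≢0}}

sumℚ prodℚ : List ℚ → ℚ
sumℚ  = foldr _+_ 0ℚ
prodℚ = foldr _*_ 1ℚ

wordTerm : ∀ {n} → (Fin n → ℚ) → List (Fin n) → ℚ
wordTerm x []               = 1ℚ
wordTerm x (a ∷ [])         = 1ℚ
wordTerm x (a ∷ b ∷ rest)   = inv (x a - x b) * wordTerm x (b ∷ rest)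

Ψ : ∀ {n} → Graph n → (Fin n → ℚ) → ℚ
Ψ G x = sumℚ (map (wordTerm x) (linExts G))

Nval : ∀ {n} → Graph n → (Fin n → ℚ) → ℚ
Nval G x = Ψ G x * prodℚ (map (λ f → x (α f) - x (ω f)) (edges G))

data Poly (n : ℕ) : Set where
  var  : Fin n → Poly n
  con  : ℚ → Poly n
  _⊕_  : Poly n → Poly n → Poly n
  _⊗_  : Poly n → Poly n → Poly n
  ⊝_   : Poly n → Poly n

eval : ∀ {n} → Poly n → (Fin n → ℚ) → ℚ
eval (var i) x = x i
eval (con c) x = c
eval (p ⊕ q) x = eval p x + eval q x
eval (p ⊗ q) x = eval p x * eval q x
eval (⊝ p)   x = - eval p x

rename : ∀ {m n} → (Fin m → Fin n) → Poly m → Poly n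
rename σ (var i) = var (σ i)
rename σ (con c) = con c
rename σ (p ⊕ q) = rename σ p ⊕ rename σ q
rename σ (p ⊗ q) = rename σ p ⊗ rename σ q
rename σ (⊝ p)   = ⊝ rename σ p

-- The polynomial P is N(G): it agrees with Ψ(G)∏(x_α - x_ω) at every
-- point with pairwise distinct coordinates (where Ψ(G) is defined).
-- Since ℚ is infinite, such points are Zariski dense, so this
-- determines P as a polynomial.
IsN : ∀ {n} → Graph n → Poly n → Set
IsN {n} G P = (x : Fin n → ℚ) → Injective _≡_ _≡_ x → eval P x ≡ Nval G x

-- The vertex v₂ is deleted and identified with v₁; the resulting
-- vertex set is Fin n, and `merge` sends each old vertex to its new name
-- (v₁ and v₂ both go to the merged vertex v).

merge : ∀ {n} (v₁ v₂ : Fin (suc n)) → v₁ ≢ v₂ → Fin (suc n) → Fin n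
merge v₁ v₂ ne k with k ≟ᶠ v₂
... | yes _  = punchOut {i = v₂} {j = v₁} (λ eq → ne (sym eq))
... | no k≢v₂ = punchOut {i = v₂} {j = k} (λ eq → k≢v₂ (sym eq))

contract : ∀ {n} (G : Graph (suc n)) (i : Fin (length (edges G))) →
           α (lookup (edges G) i) ≢ ω (lookup (edges G) i) → Graph n
contract G i ne =
  graph (map (λ f → (σ (α f) , σ (ω f))) (removeAt (edges G) i))
  where σ = merge (α (lookup (edges G) i)) (ω (lookup (edges G) i)) ne

module Submission where

-- Let σ = merge v₁ v₂ be the vertex map of the contraction and y an injective
-- point for G/e.  The hypothesis IsN G P describes P only at injective points,
-- and y ∘ σ is not one, so we approach it along the line on which only the
-- coordinate of v₂ moves: x_{v₂} = t, all other x_k = y (σ k).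
--  * Analysis.  Along the line every term of N(G) is a product of coordinate
--    differences and their inverses, hence "regular" at t = x₁ (a quotient of
--    polynomials in t with nonvanishing denominator).  A polynomial agreeing with
--    a regular function off a finite set takes its value at x₁, since a
--    polynomial vanishing off a finite set is zero.  So P(y ∘ σ) is the sum of
--    the limits of the terms of N(G).
--  * Combinatorics.  The factor x_{v₁} - x_{v₂} of e tends to 0, so a term has a
--    nonzero limit only when v₂ immediately follows v₁ in the linear extension;
--    deleting v₂ is then a bijection onto the linear extensions of G/e, and the
--    limits sum to N(G/e)(y).

open import Defs
open import Algebra.Properties.Group using (x∙y⁻¹≈ε⇒x≈y)
open import Data.Bool using (Bool; true; false; _∧_; _∨_; if_then_else_; T)
open import Data.Bool.Properties using (T?)
open import Data.Empty using (⊥; ⊥-elim)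
open import Data.Fin using (Fin; zero; suc; punchIn; punchOut)
open import Data.Fin.Properties
  using (punchIn-injective; punchInᵢ≢i; punchIn-punchOut; punchOut-cong; punchOut-injective; punchOut-punchIn)
  renaming (_≟_ to _≟ᶠ_)
open import Data.List
  using (List; []; _∷_; [_]; _++_; length; lookup; map; foldr; concatMap; filterᵇ; tabulate; allFin; removeAt)
open import Data.List.Extrema using (max; xs≤max)
open import Data.List.Membership.Propositional using (_∈_; _∉_)
open import Data.List.Membership.Propositional.Properties using (∈-tabulate⁺; ∈-tabulate⁻)
open import Data.List.Properties
  using (map-tabulate; tabulate-cong; map-cong; map-cong-local; map-∘; filter-none; filter-accept; filter-reject)
open import Data.List.Relation.Binary.Permutation.Propositional
  using (_↭_; prep; swap; ↭-sym; ↭⇒↭ₛ) renaming (refl to ↭-refl; trans to ↭-trans)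
open import Data.List.Relation.Binary.Permutation.Propositional.Properties using (∈-resp-↭)
import Data.List.Relation.Binary.Permutation.Setoid.Properties as PermutationSetoid
open import Data.List.Relation.Unary.All using (All; []; _∷_)
import Data.List.Relation.Unary.All as All
open import Data.List.Relation.Unary.All.Properties using (All¬⇒¬Any; map⁺; concat⁺)
open import Data.List.Relation.Unary.Any using (here; there; tail)
open import Data.List.Relation.Unary.Unique.Propositional using (Unique; []; _∷_)
open import Data.List.Relation.Unary.Unique.Propositional.Properties using (tabulate⁺; allFin⁺)
open import Data.Nat using (ℕ; zero; suc)
open import Data.Product using (∃; _,_; proj₁; proj₂; _×_)
open import Data.Rational using (ℚ; 0ℚ; 1ℚ; _+_; _*_; _-_; -_; _<_; _≤_; ≢-nonZero)
open import Data.Rational.Properties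
  using (+-0-group; ≤-decTotalOrder; *-inverseˡ; *-zeroʳ; *-zeroˡ; *-identityˡ; *-identityʳ;
         +-identityˡ; +-identityʳ; <⇒≢; ≤-<-trans; +-monoʳ-<; positive⁻¹)
  renaming (_≟_ to _≟ℚ_)
open import Data.Rational.Solver using (module +-*-Solver)
open +-*-Solver using (solve; _:+_; _:*_; _:-_; :-_; _:=_) renaming (con to κ)
open import Data.Sum using (_⊎_; inj₁; inj₂)
open import Function using (_∘_; id)
open import Function.Definitions using (Injective)
open import Relation.Binary.Bundles using (DecTotalOrder; TotalOrder)
open import Relation.Binary.PropositionalEquality
  using (_≡_; _≢_; refl; sym; trans; cong; cong₂; subst; ≢-sym; module ≡-Reasoning)
open import Relation.Binary.PropositionalEquality.Properties using (setoid)
open import Relation.Nullary using (Dec; yes; no; ¬_)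
open import Relation.Nullary.Decidable using (⌊_⌋)

inv-inverseˡ : ∀ q → q ≢ 0ℚ → inv q * q ≡ 1ℚ
inv-inverseˡ q q≢0 with q ≟ℚ 0ℚ
... | yes q≡0 = ⊥-elim (q≢0 q≡0)
... | no q≢0′ = *-inverseˡ q {{≢-nonZero q≢0′}}

inv-cancel : ∀ q w → q ≢ 0ℚ → q * (inv q * w) ≡ w
inv-cancel q w q≢0 = begin
  q * (inv q * w)   ≡⟨ solve 3 (λ q iq w → q :* (iq :* w) := iq :* q :* w) refl q (inv q) w ⟩
  (inv q * q) * w   ≡⟨ cong (_* w) (inv-inverseˡ q q≢0) ⟩
  1ℚ * w            ≡⟨ *-identityˡ w ⟩
  w                 ∎
  where open ≡-Reasoning

*-swap : ∀ p q w → p * (q * w) ≡ q * (p * w)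
*-swap p q w = solve 3 (λ p q w → p :* (q :* w) := q :* (p :* w)) refl p q w

nonzero-factor : ∀ x y → x * y ≡ 0ℚ → x ≢ 0ℚ → y ≡ 0ℚ
nonzero-factor x y xy≡0 x≢0 = begin
  y                 ≡⟨ sym (inv-cancel x y x≢0) ⟩
  x * (inv x * y)   ≡⟨ solve 3 (λ x ix y → x :* (ix :* y) := ix :* (x :* y)) refl x (inv x) y ⟩
  inv x * (x * y)   ≡⟨ cong (inv x *_) xy≡0 ⟩
  inv x * 0ℚ        ≡⟨ *-zeroʳ (inv x) ⟩
  0ℚ                ∎
  where open ≡-Reasoning

*-nonzero : ∀ x y → x ≢ 0ℚ → y ≢ 0ℚ → x * y ≢ 0ℚ
*-nonzero x y x≢0 y≢0 xy≡0 = y≢0 (nonzero-factor x y xy≡0 x≢0)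

sub≡0⇒≡ : ∀ p q → p - q ≡ 0ℚ → p ≡ q
sub≡0⇒≡ = x∙y⁻¹≈ε⇒x≈y +-0-group

sub-self : ∀ p → p - p ≡ 0ℚ
sub-self p = solve 1 (λ p → p :- p := κ 0ℚ) refl p

sub-nonzero : ∀ {p q} → p ≢ q → p - q ≢ 0ℚ
sub-nonzero {p} {q} p≢q eq = p≢q (sub≡0⇒≡ p q eq)

*-cancelʳ-nonzero : ∀ a b q → q ≢ 0ℚ → a * q ≡ b * q → a ≡ b
*-cancelʳ-nonzero a b q q≢0 eq = sub≡0⇒≡ a b (nonzero-factor q (a - b) q[a-b]≡0 q≢0)
  where
  q[a-b]≡0 : q * (a - b) ≡ 0ℚ
  q[a-b]≡0 = begin
    q * (a - b)       ≡⟨ solve 3 (λ a b q → q :* (a :- b) := a :* q :- b :* q) refl a b q ⟩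
    a * q - b * q     ≡⟨ cong (_- b * q) eq ⟩
    b * q - b * q     ≡⟨ sub-self (b * q) ⟩
    0ℚ                ∎
    where open ≡-Reasoning

fresh : (B : List ℚ) → ∃ λ t → t ∉ B
fresh B = t , All¬⇒¬Any (All.map below⇒≢ (xs≤max ℚ-totalOrder 0ℚ B))
  where
  ℚ-totalOrder : TotalOrder _ _ _
  ℚ-totalOrder = DecTotalOrder.totalOrder ≤-decTotalOrder
  M t : ℚ
  M = max ℚ-totalOrder 0ℚ B
  t = M + 1ℚ
  M<t : M < t
  M<t = subst (_< t) (+-identityʳ M) (+-monoʳ-< M (positive⁻¹ 1ℚ))
  below⇒≢ : ∀ {b} → b ≤ M → t ≢ b
  below⇒≢ b≤M t≡b = <⇒≢ (≤-<-trans b≤M M<t) (sym t≡b)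

-- Polynomials in one variable t, as coefficient lists (constant term first).

UPoly : Set
UPoly = List ℚ

evalU : UPoly → ℚ → ℚ
evalU []       t = 0ℚ
evalU (c ∷ cs) t = c + t * evalU cs t

constU : ℚ → UPoly
constU c = c ∷ []

varU : UPoly
varU = 0ℚ ∷ 1ℚ ∷ []

addU : UPoly → UPoly → UPoly
addU []       q        = q
addU (a ∷ p)  []       = a ∷ p
addU (a ∷ p)  (b ∷ q)  = a + b ∷ addU p q

scaleU : ℚ → UPoly → UPoly
scaleU c = map (c *_)

mulU : UPoly → UPoly → UPoly
mulU []      q = []
mulU (a ∷ p) q = addU (scaleU a q) (0ℚ ∷ mulU p q)

subU : UPoly → UPoly → UPoly
subU p q = addU p (scaleU (- 1ℚ) q)

evalU-const : ∀ c t → evalU (constU c) t ≡ c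
evalU-const c t = solve 2 (λ c t → c :+ t :* κ 0ℚ := c) refl c t

evalU-var : ∀ t → evalU varU t ≡ t
evalU-var t = solve 1 (λ t → κ 0ℚ :+ t :* (κ 1ℚ :+ t :* κ 0ℚ) := t) refl t

evalU-add : ∀ p q t → evalU (addU p q) t ≡ evalU p t + evalU q t
evalU-add []      q       t = sym (+-identityˡ _)
evalU-add (a ∷ p) []      t = sym (+-identityʳ _)
evalU-add (a ∷ p) (b ∷ q) t rewrite evalU-add p q t =
  solve 5 (λ a b t P Q → a :+ b :+ t :* (P :+ Q) := a :+ t :* P :+ (b :+ t :* Q))
    refl a b t (evalU p t) (evalU q t)

evalU-scale : ∀ c p t → evalU (scaleU c p) t ≡ c * evalU p t
evalU-scale c []      t = sym (*-zeroʳ c)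
evalU-scale c (a ∷ p) t rewrite evalU-scale c p t =
  solve 4 (λ c a t P → c :* a :+ t :* (c :* P) := c :* (a :+ t :* P)) refl c a t (evalU p t)

evalU-mul : ∀ p q t → evalU (mulU p q) t ≡ evalU p t * evalU q t
evalU-mul []      q t = sym (*-zeroˡ (evalU q t))
evalU-mul (a ∷ p) q t
  rewrite evalU-add (scaleU a q) (0ℚ ∷ mulU p q) t | evalU-scale a q t | evalU-mul p q t =
  solve 4 (λ a t P Q → a :* Q :+ (κ 0ℚ :+ t :* (P :* Q)) := (a :+ t :* P) :* Q)
    refl a t (evalU p t) (evalU q t)

evalU-sub : ∀ p q t → evalU (subU p q) t ≡ evalU p t - evalU q t
evalU-sub p q t rewrite evalU-add p (scaleU (- 1ℚ) q) t | evalU-scale (- 1ℚ) q t =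
  solve 2 (λ P Q → P :+ κ (- 1ℚ) :* Q := P :- Q) refl (evalU p t) (evalU q t)

quotU : ℚ → UPoly → UPoly
quotU a []          = []
quotU a (c ∷ [])    = []
quotU a (c ∷ d ∷ r) = evalU (d ∷ r) a ∷ quotU a (d ∷ r)

division : ∀ a p t → evalU p t ≡ evalU p a + (t - a) * evalU (quotU a p) t
division a []          t = solve 2 (λ a t → κ 0ℚ := κ 0ℚ :+ (t :- a) :* κ 0ℚ) refl a t
division a (c ∷ [])    t =
  solve 3 (λ a t c → c :+ t :* κ 0ℚ := c :+ a :* κ 0ℚ :+ (t :- a) :* κ 0ℚ) refl a t c
division a (c ∷ d ∷ r) t rewrite division a (d ∷ r) t =
  solve 5 (λ a t c R D → c :+ t :* (R :+ (t :- a) :* D) := c :+ a :* R :+ (t :- a) :* (R :+ t :* D))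
    refl a t c (evalU (d ∷ r) a) (evalU (quotU a (d ∷ r)) t)

length-quotU : ∀ a c r → length (quotU a (c ∷ r)) ≡ length r
length-quotU a c []      = refl
length-quotU a c (d ∷ r) = cong suc (length-quotU a d r)

-- A polynomial vanishing outside a finite set vanishes everywhere: pick a fresh
-- root a; then p = (t - a)·q and q vanishes outside the larger set a ∷ B.
vanishing : ∀ p (B : List ℚ) → (∀ t → t ∉ B → evalU p t ≡ 0ℚ) → ∀ t → evalU p t ≡ 0ℚ
vanishing p = go (length p) p refl
  where
  go : ∀ k p → length p ≡ k → ∀ B → (∀ t → t ∉ B → evalU p t ≡ 0ℚ) → ∀ t → evalU p t ≡ 0ℚ
  go k       []      _   B zero-off t = refl
  go zero    (c ∷ r) ()
  go (suc k) (c ∷ r) len B zero-off t = begin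
      evalU (c ∷ r) t                        ≡⟨ division a (c ∷ r) t ⟩
      evalU (c ∷ r) a + (t - a) * evalU q t  ≡⟨ cong₂ (λ u v → u + (t - a) * v) pa≡0 (q≡0 t) ⟩
      0ℚ + (t - a) * 0ℚ                      ≡⟨ solve 1 (λ x → κ 0ℚ :+ x :* κ 0ℚ := κ 0ℚ) refl (t - a) ⟩
      0ℚ                                     ∎
    where
    open ≡-Reasoning
    a : ℚ
    a = proj₁ (fresh B)
    pa≡0 : evalU (c ∷ r) a ≡ 0ℚ
    pa≡0 = zero-off a (proj₂ (fresh B))
    q : UPoly
    q = quotU a (c ∷ r)
    q-off : ∀ s → s ∉ a ∷ B → evalU q s ≡ 0ℚ
    q-off s s∉aB = nonzero-factor (s - a) (evalU q s) [s-a]q≡0 (sub-nonzero (s∉aB ∘ here))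
      where
      [s-a]q≡0 : (s - a) * evalU q s ≡ 0ℚ
      [s-a]q≡0 = begin
        (s - a) * evalU q s                    ≡⟨ sym (+-identityˡ _) ⟩
        0ℚ + (s - a) * evalU q s               ≡⟨ cong (_+ (s - a) * evalU q s) (sym pa≡0) ⟩
        evalU (c ∷ r) a + (s - a) * evalU q s  ≡⟨ sym (division a (c ∷ r) s) ⟩
        evalU (c ∷ r) s                        ≡⟨ zero-off s (s∉aB ∘ there) ⟩
        0ℚ                                     ∎
    q≡0 : ∀ s → evalU q s ≡ 0ℚ
    q≡0 = go k q (trans (length-quotU a c r) (cong Data.Nat.pred len)) (a ∷ B) q-off

eval-rename : ∀ {m k} (f : Fin m → Fin k) (P : Poly m) (x : Fin k → ℚ) → eval (rename f P) x ≡ eval P (x ∘ f)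
eval-rename f (var j) x = refl
eval-rename f (con c) x = refl
eval-rename f (P ⊕ Q) x = cong₂ _+_ (eval-rename f P x) (eval-rename f Q x)
eval-rename f (P ⊗ Q) x = cong₂ _*_ (eval-rename f P x) (eval-rename f Q x)
eval-rename f (⊝ P)   x = cong -_ (eval-rename f P x)

eval-cong : ∀ {m} (P : Poly m) {x x′ : Fin m → ℚ} → (∀ j → x j ≡ x′ j) → eval P x ≡ eval P x′
eval-cong (var j) x≡x′ = x≡x′ j
eval-cong (con c) x≡x′ = refl
eval-cong (P ⊕ Q) x≡x′ = cong₂ _+_ (eval-cong P x≡x′) (eval-cong Q x≡x′)
eval-cong (P ⊗ Q) x≡x′ = cong₂ _*_ (eval-cong P x≡x′) (eval-cong Q x≡x′)
eval-cong (⊝ P)   x≡x′ = cong -_ (eval-cong P x≡x′)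

-- This is the algebraic
-- substitute for "g extends continuously to x₁ with value c".

module Regularity (x₁ : ℚ) (B : List ℚ) where

  record Regular (g : ℚ → ℚ) (c : ℚ) : Set where
    field
      num den     : UPoly
      agrees      : ∀ t → t ∉ B → g t * evalU den t ≡ evalU num t
      den-nonzero : evalU den x₁ ≢ 0ℚ
      value       : c * evalU den x₁ ≡ evalU num x₁
  open Regular

  regular-ext : ∀ {g g′ c c′} → (∀ t → t ∉ B → g t ≡ g′ t) → c ≡ c′ → Regular g c → Regular g′ c′
  regular-ext g≡g′ refl r = record
    { num = num r ; den = den r
    ; agrees      = λ t t∉B → trans (cong (_* evalU (den r) t) (sym (g≡g′ t t∉B))) (agrees r t t∉B)
    ; den-nonzero = den-nonzero r
    ; value       = value r
    }

  regular-poly : ∀ p → Regular (evalU p) (evalU p x₁)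
  regular-poly p = record
    { num = p ; den = constU 1ℚ
    ; agrees      = λ t _ → times-one t
    ; den-nonzero = λ eq → 1≢0 (trans (sym (evalU-const 1ℚ x₁)) eq)
    ; value       = times-one x₁
    }
    where
    times-one : ∀ t → evalU p t * evalU (constU 1ℚ) t ≡ evalU p t
    times-one t = trans (cong (evalU p t *_) (evalU-const 1ℚ t)) (*-identityʳ _)
    1≢0 : 1ℚ ≢ 0ℚ
    1≢0 ()

  regular-const : ∀ c → Regular (λ _ → c) c
  regular-const c = regular-ext (λ t _ → evalU-const c t) (evalU-const c x₁) (regular-poly (constU c))

  regular-+ : ∀ {g₁ g₂ c₁ c₂} → Regular g₁ c₁ → Regular g₂ c₂ → Regular (λ t → g₁ t + g₂ t) (c₁ + c₂)
  regular-+ {g₁} {g₂} {c₁} {c₂} r₁ r₂ = record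
    { num = addU (mulU (num r₁) (den r₂)) (mulU (num r₂) (den r₁))
    ; den = mulU (den r₁) (den r₂)
    ; agrees      = λ t t∉B → law (g₁ t) (g₂ t) t (agrees r₁ t t∉B) (agrees r₂ t t∉B)
    ; den-nonzero = λ eq → *-nonzero _ _ (den-nonzero r₁) (den-nonzero r₂)
                             (trans (sym (evalU-mul (den r₁) (den r₂) x₁)) eq)
    ; value       = law c₁ c₂ x₁ (value r₁) (value r₂)
    }
    where
    law : ∀ a b t → a * evalU (den r₁) t ≡ evalU (num r₁) t → b * evalU (den r₂) t ≡ evalU (num r₂) t →
          (a + b) * evalU (mulU (den r₁) (den r₂)) t
            ≡ evalU (addU (mulU (num r₁) (den r₂)) (mulU (num r₂) (den r₁))) t
    law a b t e₁ e₂
      rewrite evalU-mul (den r₁) (den r₂) t | evalU-add (mulU (num r₁) (den r₂)) (mulU (num r₂) (den r₁)) t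
            | evalU-mul (num r₁) (den r₂) t | evalU-mul (num r₂) (den r₁) t | sym e₁ | sym e₂ =
      solve 4 (λ a b Q₁ Q₂ → (a :+ b) :* (Q₁ :* Q₂) := a :* Q₁ :* Q₂ :+ b :* Q₂ :* Q₁)
        refl a b (evalU (den r₁) t) (evalU (den r₂) t)

  regular-* : ∀ {g₁ g₂ c₁ c₂} → Regular g₁ c₁ → Regular g₂ c₂ → Regular (λ t → g₁ t * g₂ t) (c₁ * c₂)
  regular-* {g₁} {g₂} {c₁} {c₂} r₁ r₂ = record
    { num = mulU (num r₁) (num r₂)
    ; den = mulU (den r₁) (den r₂)
    ; agrees      = λ t t∉B → law (g₁ t) (g₂ t) t (agrees r₁ t t∉B) (agrees r₂ t t∉B)
    ; den-nonzero = λ eq → *-nonzero _ _ (den-nonzero r₁) (den-nonzero r₂)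
                             (trans (sym (evalU-mul (den r₁) (den r₂) x₁)) eq)
    ; value       = law c₁ c₂ x₁ (value r₁) (value r₂)
    }
    where
    law : ∀ a b t → a * evalU (den r₁) t ≡ evalU (num r₁) t → b * evalU (den r₂) t ≡ evalU (num r₂) t →
          (a * b) * evalU (mulU (den r₁) (den r₂)) t ≡ evalU (mulU (num r₁) (num r₂)) t
    law a b t e₁ e₂
      rewrite evalU-mul (den r₁) (den r₂) t | evalU-mul (num r₁) (num r₂) t | sym e₁ | sym e₂ =
      solve 4 (λ a b Q₁ Q₂ → (a :* b) :* (Q₁ :* Q₂) := a :* Q₁ :* (b :* Q₂))
        refl a b (evalU (den r₁) t) (evalU (den r₂) t)

  regular-inv : ∀ h → (∀ t → t ∉ B → evalU h t ≢ 0ℚ) → evalU h x₁ ≢ 0ℚ →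
                Regular (λ t → inv (evalU h t)) (inv (evalU h x₁))
  regular-inv h h≢0 hx₁≢0 = record
    { num = constU 1ℚ ; den = h
    ; agrees      = λ t t∉B → trans (inv-inverseˡ (evalU h t) (h≢0 t t∉B)) (sym (evalU-const 1ℚ t))
    ; den-nonzero = hx₁≢0
    ; value       = trans (inv-inverseˡ (evalU h x₁) hx₁≢0) (sym (evalU-const 1ℚ x₁))
    }

  -- Continuity principle: a polynomial f agreeing with a regular g off B takes the
  -- value c at x₁, because f·q - p vanishes off B, hence everywhere.
  regular-unique : ∀ {g c} → Regular g c → (f : UPoly) → (∀ t → t ∉ B → evalU f t ≡ g t) → evalU f x₁ ≡ c
  regular-unique {g} {c} r f f≡g =
    *-cancelʳ-nonzero (evalU f x₁) c (evalU (den r) x₁) (den-nonzero r) (trans fq≡p (sym (value r)))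
    where
    defect : UPoly
    defect = subU (mulU f (den r)) (num r)
    evalU-defect : ∀ t → evalU defect t ≡ evalU f t * evalU (den r) t - evalU (num r) t
    evalU-defect t = trans (evalU-sub (mulU f (den r)) (num r) t) (cong (_- evalU (num r) t) (evalU-mul f (den r) t))
    defect-off : ∀ t → t ∉ B → evalU defect t ≡ 0ℚ
    defect-off t t∉B = begin
      evalU defect t                                  ≡⟨ evalU-defect t ⟩
      evalU f t * evalU (den r) t - evalU (num r) t   ≡⟨ cong (λ z → z * evalU (den r) t - evalU (num r) t) (f≡g t t∉B) ⟩
      g t * evalU (den r) t - evalU (num r) t         ≡⟨ cong (_- evalU (num r) t) (agrees r t t∉B) ⟩
      evalU (num r) t - evalU (num r) t               ≡⟨ sub-self (evalU (num r) t) ⟩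
      0ℚ                                              ∎
      where open ≡-Reasoning
    fq≡p : evalU f x₁ * evalU (den r) x₁ ≡ evalU (num r) x₁
    fq≡p = sub≡0⇒≡ _ _ (trans (sym (evalU-defect x₁)) (vanishing defect B defect-off x₁))

  regular-sum : ∀ {A : Set} (ws : List A) (F : A → ℚ → ℚ) (V : A → ℚ) → All (λ w → Regular (F w) (V w)) ws →
                Regular (λ t → sumℚ (map (λ w → F w t) ws)) (sumℚ (map V ws))
  regular-sum []       F V []       = regular-const 0ℚ
  regular-sum (w ∷ ws) F V (r ∷ rs) = regular-+ r (regular-sum ws F V rs)

  regular-prod : ∀ {A : Set} (ws : List A) (F : A → ℚ → ℚ) (V : A → ℚ) → All (λ w → Regular (F w) (V w)) ws →
                 Regular (λ t → prodℚ (map (λ w → F w t) ws)) (prodℚ (map V ws))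
  regular-prod []       F V []       = regular-const 1ℚ
  regular-prod (w ∷ ws) F V (r ∷ rs) = regular-* r (regular-prod ws F V rs)

-- Finite sums over lists.  ∑ xs F is Σ_{x ∈ xs} F x, definitionally the form in
-- which Ψ and N are written in Defs.

∑ : {A : Set} → List A → (A → ℚ) → ℚ
∑ xs F = sumℚ (map F xs)

∑-cong : ∀ {A : Set} {F G : A → ℚ} xs → (∀ x → F x ≡ G x) → ∑ xs F ≡ ∑ xs G
∑-cong xs F≡G = cong sumℚ (map-cong F≡G xs)

∑-cong-All : ∀ {A : Set} {F G : A → ℚ} {xs} → All (λ x → F x ≡ G x) xs → ∑ xs F ≡ ∑ xs G
∑-cong-All F≡G = cong sumℚ (map-cong-local F≡G)

∑-map : ∀ {A B : Set} (g : A → B) xs (F : B → ℚ) → ∑ (map g xs) F ≡ ∑ xs (F ∘ g)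
∑-map g xs F = cong sumℚ (sym (map-∘ xs))

∑-++ : ∀ {A : Set} xs ys (F : A → ℚ) → ∑ (xs ++ ys) F ≡ ∑ xs F + ∑ ys F
∑-++ []       ys F = sym (+-identityˡ _)
∑-++ (x ∷ xs) ys F rewrite ∑-++ xs ys F =
  solve 3 (λ a b c → a :+ (b :+ c) := a :+ b :+ c) refl (F x) (∑ xs F) (∑ ys F)

∑-concatMap : ∀ {A B : Set} (f : A → List B) xs (F : B → ℚ) → ∑ (concatMap f xs) F ≡ ∑ xs (λ x → ∑ (f x) F)
∑-concatMap f []       F = refl
∑-concatMap f (x ∷ xs) F = trans (∑-++ (f x) (concatMap f xs) F) (cong (∑ (f x) F +_) (∑-concatMap f xs F))

∑-+ : ∀ {A : Set} xs (F G : A → ℚ) → ∑ xs (λ x → F x + G x) ≡ ∑ xs F + ∑ xs G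
∑-+ []       F G = sym (+-identityˡ 0ℚ)
∑-+ (x ∷ xs) F G rewrite ∑-+ xs F G =
  solve 4 (λ a b c d → a :+ b :+ (c :+ d) := a :+ c :+ (b :+ d)) refl (F x) (G x) (∑ xs F) (∑ xs G)

∑-*ʳ : ∀ {A : Set} xs (F : A → ℚ) c → ∑ xs F * c ≡ ∑ xs (λ x → F x * c)
∑-*ʳ []       F c = *-zeroˡ c
∑-*ʳ (x ∷ xs) F c rewrite sym (∑-*ʳ xs F c) =
  solve 3 (λ a b c → (a :+ b) :* c := a :* c :+ b :* c) refl (F x) (∑ xs F) c

∑-zero : ∀ {A : Set} (xs : List A) → ∑ xs (λ _ → 0ℚ) ≡ 0ℚ
∑-zero []       = refl
∑-zero (x ∷ xs) = trans (+-identityˡ _) (∑-zero xs)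

∑-filter : ∀ {A : Set} (p : A → Bool) xs (F : A → ℚ) → ∑ (filterᵇ p xs) F ≡ ∑ xs (λ x → if p x then F x else 0ℚ)
∑-filter p []       F = refl
∑-filter p (x ∷ xs) F with p x
... | true  = cong (F x +_) (∑-filter p xs F)
... | false = trans (∑-filter p xs F) (sym (+-identityˡ _))

∑perms-cons : ∀ {A : Set} (a : A) l F → ∑ (perms (a ∷ l)) F ≡ ∑ (perms l) (λ u → ∑ (insertions a u) F)
∑perms-cons a l F = ∑-concatMap (insertions a) (perms l) F

insert₂ : ∀ {A : Set} → A → A → List A → (List A → ℚ) → ℚ
insert₂ a b z F = ∑ (insertions b z) (λ v → ∑ (insertions a v) F)

insert₂-cons : ∀ {A : Set} (a b c : A) z F → insert₂ a b (c ∷ z) F ≡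
  (F (a ∷ b ∷ c ∷ z) + (F (b ∷ a ∷ c ∷ z) + ∑ (insertions a z) (λ w → F (b ∷ c ∷ w))))
  + (∑ (insertions b z) (λ v → F (a ∷ c ∷ v)) + insert₂ a b z (λ w → F (c ∷ w)))
insert₂-cons a b c z F = cong₂ _+_ a-into-bcz rest
  where
  open ≡-Reasoning
  a-into-bcz : ∑ (insertions a (b ∷ c ∷ z)) F
             ≡ F (a ∷ b ∷ c ∷ z) + (F (b ∷ a ∷ c ∷ z) + ∑ (insertions a z) (λ w → F (b ∷ c ∷ w)))
  a-into-bcz = cong (F (a ∷ b ∷ c ∷ z) +_) (begin
    ∑ (map (b ∷_) (insertions a (c ∷ z))) F
      ≡⟨ ∑-map (b ∷_) (insertions a (c ∷ z)) F ⟩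
    F (b ∷ a ∷ c ∷ z) + ∑ (map (c ∷_) (insertions a z)) (λ w → F (b ∷ w))
      ≡⟨ cong (F (b ∷ a ∷ c ∷ z) +_) (∑-map (c ∷_) (insertions a z) (λ w → F (b ∷ w))) ⟩
    F (b ∷ a ∷ c ∷ z) + ∑ (insertions a z) (λ w → F (b ∷ c ∷ w)) ∎)
  rest : ∑ (map (c ∷_) (insertions b z)) (λ v → ∑ (insertions a v) F)
       ≡ ∑ (insertions b z) (λ v → F (a ∷ c ∷ v)) + insert₂ a b z (λ w → F (c ∷ w))
  rest = begin
    ∑ (map (c ∷_) (insertions b z)) (λ v → ∑ (insertions a v) F)
      ≡⟨ ∑-map (c ∷_) (insertions b z) (λ v → ∑ (insertions a v) F) ⟩
    ∑ (insertions b z) (λ v → F (a ∷ c ∷ v) + ∑ (map (c ∷_) (insertions a v)) F)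
      ≡⟨ ∑-cong (insertions b z) (λ v → cong (F (a ∷ c ∷ v) +_) (∑-map (c ∷_) (insertions a v) F)) ⟩
    ∑ (insertions b z) (λ v → F (a ∷ c ∷ v) + ∑ (insertions a v) (λ w → F (c ∷ w)))
      ≡⟨ ∑-+ (insertions b z) (λ v → F (a ∷ c ∷ v)) (λ v → ∑ (insertions a v) (λ w → F (c ∷ w))) ⟩
    ∑ (insertions b z) (λ v → F (a ∷ c ∷ v)) + insert₂ a b z (λ w → F (c ∷ w)) ∎

insert₂-comm : ∀ {A : Set} (a b : A) z F → insert₂ a b z F ≡ insert₂ b a z F
insert₂-comm a b [] F =
  solve 2 (λ x y → x :+ (y :+ κ 0ℚ) :+ κ 0ℚ := y :+ (x :+ κ 0ℚ) :+ κ 0ℚ) refl (F (a ∷ b ∷ [])) (F (b ∷ a ∷ []))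
insert₂-comm a b (c ∷ z) F
  rewrite insert₂-cons a b c z F | insert₂-cons b a c z F | insert₂-comm a b z (λ w → F (c ∷ w)) =
  solve 5 (λ A₁ A₂ S₁ S₂ t → A₁ :+ (A₂ :+ S₁) :+ (S₂ :+ t) := A₂ :+ (A₁ :+ S₂) :+ (S₁ :+ t)) refl
    (F (a ∷ b ∷ c ∷ z)) (F (b ∷ a ∷ c ∷ z)) (∑ (insertions a z) (λ w → F (b ∷ c ∷ w)))
    (∑ (insertions b z) (λ v → F (a ∷ c ∷ v))) (insert₂ b a z (λ w → F (c ∷ w)))

∑perms-↭ : ∀ {A : Set} {l l′ : List A} → l ↭ l′ → ∀ F → ∑ (perms l) F ≡ ∑ (perms l′) F
∑perms-↭ ↭-refl F = refl
∑perms-↭ (prep {xs} {ys} x p) F =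
  trans (∑perms-cons x xs F) (trans (∑perms-↭ p _) (sym (∑perms-cons x ys F)))
∑perms-↭ (swap {xs} {ys} x y p) F = begin
  ∑ (perms (x ∷ y ∷ xs)) F                   ≡⟨ ∑perms-cons x (y ∷ xs) F ⟩
  ∑ (perms (y ∷ xs)) _                       ≡⟨ ∑perms-cons y xs _ ⟩
  ∑ (perms xs) (λ u → insert₂ x y u F)       ≡⟨ ∑perms-↭ p _ ⟩
  ∑ (perms ys) (λ u → insert₂ x y u F)       ≡⟨ ∑-cong (perms ys) (λ u → insert₂-comm x y u F) ⟩
  ∑ (perms ys) (λ u → insert₂ y x u F)       ≡⟨ sym (∑perms-cons x ys _) ⟩
  ∑ (perms (x ∷ ys)) _                       ≡⟨ sym (∑perms-cons y (x ∷ ys) F) ⟩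
  ∑ (perms (y ∷ x ∷ ys)) F                   ∎
  where open ≡-Reasoning
∑perms-↭ (↭-trans p q) F = trans (∑perms-↭ p F) (∑perms-↭ q F)

insertions-map : ∀ {A B : Set} (f : A → B) a u → insertions (f a) (map f u) ≡ map (map f) (insertions a u)
insertions-map f a []      = refl
insertions-map f a (b ∷ u) = cong ((f a ∷ f b ∷ map f u) ∷_) (begin
  map (f b ∷_) (insertions (f a) (map f u))   ≡⟨ cong (map (f b ∷_)) (insertions-map f a u) ⟩
  map (f b ∷_) (map (map f) (insertions a u)) ≡⟨ sym (map-∘ (insertions a u)) ⟩
  map (map f ∘ (b ∷_)) (insertions a u)       ≡⟨ map-∘ (insertions a u) ⟩
  map (map f) (map (b ∷_) (insertions a u))   ∎)
  where open ≡-Reasoning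

∑perms-map : ∀ {A B : Set} (f : A → B) l (K : List B → ℚ) → ∑ (perms (map f l)) K ≡ ∑ (perms l) (K ∘ map f)
∑perms-map f []      K = refl
∑perms-map f (a ∷ l) K = begin
  ∑ (perms (f a ∷ map f l)) K                                  ≡⟨ ∑perms-cons (f a) (map f l) K ⟩
  ∑ (perms (map f l)) (λ z → ∑ (insertions (f a) z) K)         ≡⟨ ∑perms-map f l _ ⟩
  ∑ (perms l) (λ u → ∑ (insertions (f a) (map f u)) K)         ≡⟨ ∑-cong (perms l) insert-renamed ⟩
  ∑ (perms l) (λ u → ∑ (insertions a u) (K ∘ map f))           ≡⟨ sym (∑perms-cons a l _) ⟩
  ∑ (perms (a ∷ l)) (K ∘ map f)                                ∎
  where
  open ≡-Reasoning
  insert-renamed : ∀ u → ∑ (insertions (f a) (map f u)) K ≡ ∑ (insertions a u) (K ∘ map f)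
  insert-renamed u = trans (cong (λ ws → ∑ ws K) (insertions-map f a u)) (∑-map (map f) (insertions a u) K)

insertions-↭ : ∀ {A : Set} (a : A) u → All (_↭ a ∷ u) (insertions a u)
insertions-↭ a []      = ↭-refl ∷ []
insertions-↭ a (b ∷ u) = ↭-refl ∷ map⁺ (All.map (λ w↭au → ↭-trans (prep b w↭au) (swap b a ↭-refl)) (insertions-↭ a u))

perms-↭ : ∀ {A : Set} (l : List A) → All (_↭ l) (perms l)
perms-↭ []      = ↭-refl ∷ []
perms-↭ (a ∷ l) = concat⁺ (map⁺ (All.map (λ {u} u↭l → All.map (λ w↭au → ↭-trans w↭au (prep a u↭l)) (insertions-↭ a u))
                                         (perms-↭ l)))

tabulate-↭ : ∀ {A : Set} {n} (f : Fin (suc n) → A) (v : Fin (suc n)) → tabulate f ↭ f v ∷ tabulate (f ∘ punchIn v)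
tabulate-↭ f           zero    = ↭-refl
tabulate-↭ {n = suc n} f (suc v) = ↭-trans (prep (f zero) (tabulate-↭ (f ∘ suc) v)) (swap _ _ ↭-refl)

prodℚ-removeAt : ∀ {A : Set} (F : A → ℚ) (xs : List A) i →
                 prodℚ (map F xs) ≡ F (lookup xs i) * prodℚ (map F (removeAt xs i))
prodℚ-removeAt F (x ∷ xs) zero    = refl
prodℚ-removeAt F (x ∷ xs) (suc i) rewrite prodℚ-removeAt F xs i =
  solve 3 (λ a b c → a :* (b :* c) := b :* (a :* c)) refl (F x) (F (lookup xs i)) (prodℚ (map F (removeAt xs i)))

prodℚ-nonzero : ∀ {A : Set} (F : A → ℚ) xs → prodℚ (map F xs) ≢ 0ℚ → All (λ x → F x ≢ 0ℚ) xs
prodℚ-nonzero F []       _     = []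
prodℚ-nonzero F (x ∷ xs) Π≢0 =
  (λ Fx≡0 → Π≢0 (trans (cong (_* prodℚ (map F xs)) Fx≡0) (*-zeroˡ (prodℚ (map F xs)))))
  ∷ prodℚ-nonzero F xs (λ Π′≡0 → Π≢0 (trans (cong (F x *_) Π′≡0) (*-zeroʳ (F x))))

∧-true-left : ∀ {x y} → x ∧ y ≡ true → x ≡ true
∧-true-left {true} _ = refl

-- The conjunction of p over a list, in the form used by isLinExt.
allᵇ : ∀ {A : Set} → (A → Bool) → List A → Bool
allᵇ p = foldr (λ x acc → p x ∧ acc) true

allᵇ-removeAt : ∀ {A : Set} (p : A → Bool) (xs : List A) i → allᵇ p xs ≡ p (lookup xs i) ∧ allᵇ p (removeAt xs i)
allᵇ-removeAt p (x ∷ xs) zero    = refl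
allᵇ-removeAt p (x ∷ xs) (suc i) rewrite allᵇ-removeAt p xs i with p x | p (lookup xs i)
... | true  | _     = refl
... | false | true  = refl
... | false | false = refl

allᵇ-map : ∀ {A B : Set} (p : B → Bool) (g : A → B) xs → allᵇ p (map g xs) ≡ allᵇ (p ∘ g) xs
allᵇ-map p g []       = refl
allᵇ-map p g (x ∷ xs) = cong (p (g x) ∧_) (allᵇ-map p g xs)

allᵇ-cong-All : ∀ {A : Set} {p q : A → Bool} {xs} → All (λ x → p x ≡ q x) xs → allᵇ p xs ≡ allᵇ q xs
allᵇ-cong-All []           = refl
allᵇ-cong-All (px≡qx ∷ eqs) = cong₂ _∧_ px≡qx (allᵇ-cong-All eqs)

filterᵇ-map : ∀ {A B : Set} (f : A → B) {p : B → Bool} {q : A → Bool} → (∀ x → p (f x) ≡ q x) →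
              ∀ xs → filterᵇ p (map f xs) ≡ map f (filterᵇ q xs)
filterᵇ-map f {p} {q} pf≡q []       = refl
filterᵇ-map f {p} {q} pf≡q (x ∷ xs) rewrite pf≡q x with q x
... | true  = cong (f x ∷_) (filterᵇ-map f pf≡q xs)
... | false = filterᵇ-map f pf≡q xs

filterᵇ-none : ∀ {A : Set} {p : A → Bool} {xs} → All (λ x → p x ≡ false) xs → filterᵇ p xs ≡ []
filterᵇ-none {p = p} px≡false = filter-none (T? ∘ p) (All.map (subst T) px≡false)

filterᵇ-accept : ∀ {A : Set} (p : A → Bool) {x} xs → p x ≡ true → filterᵇ p (x ∷ xs) ≡ x ∷ filterᵇ p xs
filterᵇ-accept p xs px≡true = filter-accept (T? ∘ p) (subst T (sym px≡true) _)

filterᵇ-reject : ∀ {A : Set} (p : A → Bool) {x} xs → p x ≡ false → filterᵇ p (x ∷ xs) ≡ filterᵇ p xs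
filterᵇ-reject p xs px≡false = filter-reject (T? ∘ p) (subst T px≡false)

before-flip : ∀ {m} (a b : Fin m) w → before a b w ≡ true → before b a w ≡ false
before-flip a b (x ∷ xs) a<b with x ≟ᶠ b | x ≟ᶠ a
before-flip a b (x ∷ xs) () | yes _ | _
... | no _  | yes _ = refl
... | no _  | no _  = before-flip a b xs a<b

before-skip : ∀ {m} (a b : Fin m) {x} xs → x ≢ a → x ≢ b → before a b (x ∷ xs) ≡ before a b xs
before-skip a b {x} xs x≢a x≢b with x ≟ᶠ b | x ≟ᶠ a
... | yes x≡b | _       = ⊥-elim (x≢b x≡b)
... | no _    | yes x≡a = ⊥-elim (x≢a x≡a)
... | no _    | no _    = refl

before-start : ∀ {m} (a b : Fin m) xs → a ≢ b → before a b (a ∷ xs) ≡ true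
before-start a b xs a≢b with a ≟ᶠ b | a ≟ᶠ a
... | yes a≡b | _      = ⊥-elim (a≢b a≡b)
... | no _    | yes _  = refl
... | no _    | no a≢a = ⊥-elim (a≢a refl)

before-end : ∀ {m} (a b : Fin m) xs → before a b (b ∷ xs) ≡ false
before-end a b xs with b ≟ᶠ b
... | yes _   = refl
... | no b≢b  = ⊥-elim (b≢b refl)

wordTerm-map : ∀ {m k} (x : Fin k → ℚ) (g : Fin m → Fin k) u → wordTerm (x ∘ g) u ≡ wordTerm x (map g u)
wordTerm-map x g []          = refl
wordTerm-map x g (a ∷ [])    = refl
wordTerm-map x g (a ∷ b ∷ r) = cong (inv (x (g a) - x (g b)) *_) (wordTerm-map x g (b ∷ r))

wordTerm-head : ∀ {m} (x : Fin m → ℚ) {a b} r → x a ≡ x b → wordTerm x (a ∷ r) ≡ wordTerm x (b ∷ r)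
wordTerm-head x []      xa≡xb = refl
wordTerm-head x (c ∷ r) xa≡xb = cong (λ z → inv (z - x c) * wordTerm x (c ∷ r)) xa≡xb

guard-*ʳ : ∀ (l : Bool) a c → (if l then a else 0ℚ) * c ≡ (if l then a * c else 0ℚ)
guard-*ʳ true  a c = refl
guard-*ʳ false a c = *-zeroˡ c

guard-swap : ∀ (l b : Bool) (W Y : ℚ) →
             (if l then (if b then W else 0ℚ) * Y else 0ℚ) ≡ (if b then (if l then W * Y else 0ℚ) else 0ℚ)
guard-swap true  true  W Y = refl
guard-swap true  false W Y = *-zeroˡ Y
guard-swap false true  W Y = refl
guard-swap false false W Y = refl

edgeProduct : ∀ {m} → Graph m → (Fin m → ℚ) → ℚ
edgeProduct H x = prodℚ (map (λ f → x (α f) - x (ω f)) (edges H))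

Nval-as-sum : ∀ {m} (H : Graph m) (x : Fin m → ℚ) →
              Nval H x ≡ ∑ (perms (allFin m)) (λ w → if isLinExt H w then wordTerm x w * edgeProduct H x else 0ℚ)
Nval-as-sum {m} H x = begin
  ∑ (filterᵇ (isLinExt H) (perms (allFin m))) (wordTerm x) * edgeProduct H x
    ≡⟨ cong (_* edgeProduct H x) (∑-filter (isLinExt H) (perms (allFin m)) (wordTerm x)) ⟩
  ∑ (perms (allFin m)) (λ w → if isLinExt H w then wordTerm x w else 0ℚ) * edgeProduct H x
    ≡⟨ ∑-*ʳ (perms (allFin m)) _ (edgeProduct H x) ⟩
  ∑ (perms (allFin m)) (λ w → (if isLinExt H w then wordTerm x w else 0ℚ) * edgeProduct H x)
    ≡⟨ ∑-cong (perms (allFin m)) (λ w → guard-*ʳ (isLinExt H w) (wordTerm x w) (edgeProduct H x)) ⟩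
  ∑ (perms (allFin m)) (λ w → if isLinExt H w then wordTerm x w * edgeProduct H x else 0ℚ) ∎
  where open ≡-Reasoning

unique-head : ∀ {A : Set} {a : A} {r} → Unique (a ∷ r) → a ∉ r
unique-head (a∉r ∷ _) = All¬⇒¬Any a∉r

unique-↭ : ∀ {A : Set} {xs ys : List A} → xs ↭ ys → Unique xs → Unique ys
unique-↭ xs↭ys = PermutationSetoid.Unique-resp-↭ (setoid _) (↭⇒↭ₛ xs↭ys)

module Contraction {n : ℕ} (G : Graph (suc n)) (i : Fin (length (edges G)))
                   (v₁≢v₂ : α (lookup (edges G) i) ≢ ω (lookup (edges G) i)) where

  v₁ v₂ : Fin (suc n)
  v₁ = α (lookup (edges G) i)
  v₂ = ω (lookup (edges G) i)

  σ : Fin (suc n) → Fin n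
  σ = merge v₁ v₂ v₁≢v₂

  others : List (Edge (suc n))
  others = removeAt (edges G) i

  v₂≢v₁ : v₂ ≢ v₁
  v₂≢v₁ = ≢-sym v₁≢v₂

  σ-off : ∀ {k} (k≢v₂ : k ≢ v₂) → σ k ≡ punchOut (≢-sym k≢v₂)
  σ-off {k} k≢v₂ with k ≟ᶠ v₂
  ... | yes k≡v₂ = ⊥-elim (k≢v₂ k≡v₂)
  ... | no _     = punchOut-cong v₂ refl

  σ-v₂ : σ v₂ ≡ σ v₁
  σ-v₂ with v₂ ≟ᶠ v₂
  ... | yes _    = sym (trans (σ-off v₁≢v₂) (punchOut-cong v₂ refl))
  ... | no v₂≢v₂ = ⊥-elim (v₂≢v₂ refl)

  σ-injective : ∀ {a b} → a ≢ v₂ → b ≢ v₂ → σ a ≡ σ b → a ≡ b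
  σ-injective {a} {b} a≢v₂ b≢v₂ σa≡σb =
    punchOut-injective (≢-sym a≢v₂) (≢-sym b≢v₂) (trans (sym (σ-off a≢v₂)) (trans σa≡σb (σ-off b≢v₂)))

  σ-merged : ∀ {x} → σ x ≡ σ v₁ → x ≡ v₁ ⊎ x ≡ v₂
  σ-merged {x} σx≡σv₁ = by-cases (x ≟ᶠ v₂)
    where
    by-cases : Dec (x ≡ v₂) → x ≡ v₁ ⊎ x ≡ v₂
    by-cases (yes x≡v₂) = inj₂ x≡v₂
    by-cases (no x≢v₂)  = inj₁ (σ-injective x≢v₂ v₁≢v₂ σx≡σv₁)

  σ-fibre : ∀ {x b} → x ≢ v₁ → x ≢ v₂ → σ x ≡ σ b → x ≡ b
  σ-fibre {x} {b} x≢v₁ x≢v₂ σx≡σb = by-cases (b ≟ᶠ v₂)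
    where
    by-cases : Dec (b ≡ v₂) → x ≡ b
    by-cases (yes refl)  = ⊥-elim (x≢v₁ (σ-injective x≢v₂ v₁≢v₂ (trans σx≡σb σ-v₂)))
    by-cases (no b≢v₂)   = σ-injective x≢v₂ b≢v₂ σx≡σb

  σ-separates : ∀ {a b} → a ≢ b → ¬ (a ≡ v₁ × b ≡ v₂) → ¬ (a ≡ v₂ × b ≡ v₁) → σ a ≢ σ b
  σ-separates {a} {b} a≢b not-e not-e⁻¹ σa≡σb = by-cases (a ≟ᶠ v₂) (b ≟ᶠ v₂)
    where
    by-cases : Dec (a ≡ v₂) → Dec (b ≡ v₂) → ⊥
    by-cases (yes a≡v₂) (yes b≡v₂) = a≢b (trans a≡v₂ (sym b≡v₂))
    by-cases (yes refl) (no b≢v₂)  = not-e⁻¹ (refl , σ-injective b≢v₂ v₁≢v₂ (trans (sym σa≡σb) σ-v₂))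
    by-cases (no a≢v₂)  (yes refl) = not-e (σ-injective a≢v₂ v₁≢v₂ (trans σa≡σb σ-v₂) , refl)
    by-cases (no a≢v₂)  (no b≢v₂)  = a≢b (σ-injective a≢v₂ b≢v₂ σa≡σb)

  σ-punchIn : ∀ j → σ (punchIn v₂ j) ≡ j
  σ-punchIn j = trans (σ-off (punchInᵢ≢i v₂ j)) (trans (punchOut-cong v₂ refl) (punchOut-punchIn v₂))

  -- Words over the vertices of G.  A linear extension of G puts v₁ before v₂;
  -- it contributes to N(G/e) only when v₂ comes immediately after v₁.

  adjacent : List (Fin (suc n)) → Bool
  adjacent []          = false
  adjacent (a ∷ [])    = false
  adjacent (a ∷ b ∷ r) = (⌊ a ≟ᶠ v₁ ⌋ ∧ ⌊ b ≟ᶠ v₂ ⌋) ∨ adjacent (b ∷ r)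

  deleteV₂ : List (Fin (suc n)) → List (Fin (suc n))
  deleteV₂ []      = []
  deleteV₂ (a ∷ r) with a ≟ᶠ v₂
  ... | yes _ = deleteV₂ r
  ... | no _  = a ∷ deleteV₂ r

  insertV₂ : List (Fin (suc n)) → List (Fin (suc n))
  insertV₂ []      = []
  insertV₂ (c ∷ u) with c ≟ᶠ v₁
  ... | yes _ = c ∷ v₂ ∷ u
  ... | no _  = c ∷ insertV₂ u

  adjacent-cons : ∀ {c} w → c ≢ v₁ → adjacent (c ∷ w) ≡ adjacent w
  adjacent-cons {c} []      c≢v₁ = refl
  adjacent-cons {c} (b ∷ r) c≢v₁ with c ≟ᶠ v₁
  ... | yes c≡v₁ = ⊥-elim (c≢v₁ c≡v₁)
  ... | no _     = refl

  adjacent-skip : ∀ a {b} r → b ≢ v₂ → adjacent (a ∷ b ∷ r) ≡ adjacent (b ∷ r)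
  adjacent-skip a {b} r b≢v₂ with b ≟ᶠ v₂
  ... | yes b≡v₂ = ⊥-elim (b≢v₂ b≡v₂)
  ... | no _ with ⌊ a ≟ᶠ v₁ ⌋
  ...   | true  = refl
  ...   | false = refl

  adjacent-hit : ∀ r → adjacent (v₁ ∷ v₂ ∷ r) ≡ true
  adjacent-hit r with v₁ ≟ᶠ v₁ | v₂ ≟ᶠ v₂
  ... | yes _    | yes _    = refl
  ... | no v₁≢v₁ | _        = ⊥-elim (v₁≢v₁ refl)
  ... | _        | no v₂≢v₂ = ⊥-elim (v₂≢v₂ refl)

  adjacent-without-v₁ : ∀ z → v₁ ∉ z → adjacent z ≡ false
  adjacent-without-v₁ []          v₁∉z = refl
  adjacent-without-v₁ (a ∷ [])    v₁∉z = refl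
  adjacent-without-v₁ (a ∷ b ∷ r) v₁∉z =
    trans (adjacent-cons (b ∷ r) (≢-sym (v₁∉z ∘ here))) (adjacent-without-v₁ (b ∷ r) (v₁∉z ∘ there))

  adjacent-without-v₂ : ∀ z → v₂ ∉ z → adjacent z ≡ false
  adjacent-without-v₂ []          v₂∉z = refl
  adjacent-without-v₂ (a ∷ [])    v₂∉z = refl
  adjacent-without-v₂ (a ∷ b ∷ r) v₂∉z =
    trans (adjacent-skip a r (≢-sym (v₂∉z ∘ there ∘ here))) (adjacent-without-v₂ (b ∷ r) (v₂∉z ∘ there))

  deleteV₂-keep : ∀ {a} r → a ≢ v₂ → deleteV₂ (a ∷ r) ≡ a ∷ deleteV₂ r
  deleteV₂-keep {a} r a≢v₂ with a ≟ᶠ v₂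
  ... | yes a≡v₂ = ⊥-elim (a≢v₂ a≡v₂)
  ... | no _     = refl

  deleteV₂-drop : ∀ r → deleteV₂ (v₂ ∷ r) ≡ deleteV₂ r
  deleteV₂-drop r with v₂ ≟ᶠ v₂
  ... | yes _    = refl
  ... | no v₂≢v₂ = ⊥-elim (v₂≢v₂ refl)

  deleteV₂-without-v₂ : ∀ r → v₂ ∉ r → deleteV₂ r ≡ r
  deleteV₂-without-v₂ []      _    = refl
  deleteV₂-without-v₂ (a ∷ r) v₂∉r =
    trans (deleteV₂-keep r (≢-sym (v₂∉r ∘ here))) (cong (a ∷_) (deleteV₂-without-v₂ r (v₂∉r ∘ there)))

  deleteV₂-pair : ∀ r → v₂ ∉ r → deleteV₂ (v₁ ∷ v₂ ∷ r) ≡ v₁ ∷ r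
  deleteV₂-pair r v₂∉r =
    trans (deleteV₂-keep (v₂ ∷ r) v₁≢v₂) (cong (v₁ ∷_) (trans (deleteV₂-drop r) (deleteV₂-without-v₂ r v₂∉r)))

  insertV₂-hit : ∀ u → insertV₂ (v₁ ∷ u) ≡ v₁ ∷ v₂ ∷ u
  insertV₂-hit u with v₁ ≟ᶠ v₁
  ... | yes _    = refl
  ... | no v₁≢v₁ = ⊥-elim (v₁≢v₁ refl)

  insertV₂-miss : ∀ {c} u → c ≢ v₁ → insertV₂ (c ∷ u) ≡ c ∷ insertV₂ u
  insertV₂-miss {c} u c≢v₁ with c ≟ᶠ v₁
  ... | yes c≡v₁ = ⊥-elim (c≢v₁ c≡v₁)
  ... | no _     = refl

  deleteV₂-insertV₂ : ∀ u → v₂ ∉ u → deleteV₂ (insertV₂ u) ≡ u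
  deleteV₂-insertV₂ []      _    = refl
  deleteV₂-insertV₂ (c ∷ u) v₂∉cu with c ≟ᶠ v₁
  ... | yes refl = deleteV₂-pair u (v₂∉cu ∘ there)
  ... | no c≢v₁  = trans (deleteV₂-keep (insertV₂ u) (≢-sym (v₂∉cu ∘ here)))
                         (cong (c ∷_) (deleteV₂-insertV₂ u (v₂∉cu ∘ there)))

  -- Inserting v₂ into a word u that avoids it.  The heart of the contraction
  -- formula: exactly one insertion puts v₂ right after v₁, namely insertV₂ u.

  insertions-without-v₁ : ∀ u → v₁ ∉ u → filterᵇ adjacent (insertions v₂ u) ≡ []
  insertions-without-v₁ u v₁∉u =
    filterᵇ-none (All.map (λ w↭v₂u → adjacent-without-v₁ _ (v₁∉v₂u ∘ ∈-resp-↭ w↭v₂u)) (insertions-↭ v₂ u))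
    where
    v₁∉v₂u : v₁ ∉ v₂ ∷ u
    v₁∉v₂u (here v₁≡v₂) = v₁≢v₂ v₁≡v₂
    v₁∉v₂u (there v₁∈u) = v₁∉u v₁∈u

  insertions-after-v₁ : ∀ u → v₁ ∉ u → v₂ ∉ u → filterᵇ (adjacent ∘ (v₁ ∷_)) (insertions v₂ u) ≡ [ v₂ ∷ u ]
  insertions-after-v₁ []      _     _     = filterᵇ-accept (adjacent ∘ (v₁ ∷_)) [] (adjacent-hit [])
  insertions-after-v₁ (d ∷ u) v₁∉du v₂∉du =
    trans (filterᵇ-accept (adjacent ∘ (v₁ ∷_)) (map (d ∷_) (insertions v₂ u)) (adjacent-hit (d ∷ u)))
          (cong ((v₂ ∷ d ∷ u) ∷_) (trans (filterᵇ-map (d ∷_) skip-d (insertions v₂ u))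
                                         (cong (map (d ∷_)) (insertions-without-v₁ u (v₁∉du ∘ there)))))
    where
    skip-d : ∀ w → adjacent (v₁ ∷ d ∷ w) ≡ adjacent w
    skip-d w = trans (adjacent-skip v₁ w (≢-sym (v₂∉du ∘ here))) (adjacent-cons w (≢-sym (v₁∉du ∘ here)))

  adjacent-insertions : ∀ u → Unique u → v₂ ∉ u → v₁ ∈ u → filterᵇ adjacent (insertions v₂ u) ≡ [ insertV₂ u ]
  adjacent-insertions (c ∷ u) (c∉u ∷ u-unique) v₂∉cu v₁∈cu =
    trans (filterᵇ-reject adjacent {v₂ ∷ c ∷ u} (map (c ∷_) (insertions v₂ u)) front-fails) (by-cases (c ≟ᶠ v₁))
    where
    front-fails : adjacent (v₂ ∷ c ∷ u) ≡ false
    front-fails = trans (adjacent-cons {v₂} (c ∷ u) v₂≢v₁) (adjacent-without-v₂ (c ∷ u) v₂∉cu)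
    by-cases : Dec (c ≡ v₁) → filterᵇ adjacent (map (c ∷_) (insertions v₂ u)) ≡ [ insertV₂ (c ∷ u) ]
    by-cases (yes refl) =
      trans (filterᵇ-map (v₁ ∷_) (λ _ → refl) (insertions v₂ u))
            (trans (cong (map (v₁ ∷_)) (insertions-after-v₁ u (All¬⇒¬Any c∉u) (v₂∉cu ∘ there)))
                   (cong [_] (sym (insertV₂-hit u))))
    by-cases (no c≢v₁) =
      trans (filterᵇ-map (c ∷_) (λ w → adjacent-cons w c≢v₁) (insertions v₂ u))
            (trans (cong (map (c ∷_)) (adjacent-insertions u u-unique (v₂∉cu ∘ there) v₁∈u))
                   (cong [_] (sym (insertV₂-miss u c≢v₁))))
      where
      v₁∈u : v₁ ∈ u
      v₁∈u = tail (c≢v₁ ∘ sym) v₁∈cu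

  module _ {a b : Fin (suc n)} (σa≢σb : σ a ≢ σ b) where

    a≢b : a ≢ b
    a≢b a≡b = σa≢σb (cong σ a≡b)

    before-step : ∀ {x} xs ys → x ≢ v₁ → x ≢ v₂ → before a b xs ≡ before (σ a) (σ b) ys →
                  before a b (x ∷ xs) ≡ before (σ a) (σ b) (σ x ∷ ys)
    before-step {x} xs ys x≢v₁ x≢v₂ rest = by-cases (x ≟ᶠ b) (x ≟ᶠ a)
      where
      by-cases : Dec (x ≡ b) → Dec (x ≡ a) → before a b (x ∷ xs) ≡ before (σ a) (σ b) (σ x ∷ ys)
      by-cases (yes refl) _          = trans (before-end a b xs) (sym (before-end (σ a) (σ b) ys))
      by-cases (no x≢b)   (yes refl) = trans (before-start a b xs a≢b) (sym (before-start (σ a) (σ b) ys σa≢σb))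
      by-cases (no x≢b)   (no x≢a)   =
        trans (before-skip a b xs x≢a x≢b)
              (trans rest (sym (before-skip (σ a) (σ b) ys (x≢a ∘ σ-fibre x≢v₁ x≢v₂) (x≢b ∘ σ-fibre x≢v₁ x≢v₂))))

    -- The pair v₁ v₂ plays the role of the single merged letter σ v₁.
    before-pair : ∀ xs ys → before a b xs ≡ before (σ a) (σ b) ys →
                  before a b (v₁ ∷ v₂ ∷ xs) ≡ before (σ a) (σ b) (σ v₁ ∷ ys)
    before-pair xs ys rest with σ b ≟ᶠ σ v₁
    ... | yes σb≡σv₁ = trans (b-merged (σ-merged σb≡σv₁)) (sym (subst (λ z → before (σ a) (σ b) (z ∷ ys) ≡ false)
                                                                      σb≡σv₁ (before-end (σ a) (σ b) ys)))
      where
      b-merged : b ≡ v₁ ⊎ b ≡ v₂ → before a b (v₁ ∷ v₂ ∷ xs) ≡ false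
      b-merged (inj₁ refl) = before-end a b (v₂ ∷ xs)
      b-merged (inj₂ refl) = trans (before-skip a b (v₂ ∷ xs) v₁≢a v₁≢v₂) (before-end a b xs)
        where
        v₁≢a : v₁ ≢ a
        v₁≢a v₁≡a = σa≢σb (trans (cong σ (sym v₁≡a)) (sym σ-v₂))
    ... | no σb≢σv₁ with σ a ≟ᶠ σ v₁
    ...   | yes σa≡σv₁ = trans (a-merged (σ-merged σa≡σv₁)) (sym (subst (λ z → before (σ a) (σ b) (z ∷ ys) ≡ true)
                                                                      σa≡σv₁ (before-start (σ a) (σ b) ys σa≢σb)))
      where
      v≢b : ∀ {v} → σ v ≡ σ v₁ → v ≢ b
      v≢b σv≡σv₁ v≡b = σb≢σv₁ (trans (cong σ (sym v≡b)) σv≡σv₁)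
      a-merged : a ≡ v₁ ⊎ a ≡ v₂ → before a b (v₁ ∷ v₂ ∷ xs) ≡ true
      a-merged (inj₁ refl) = before-start a b (v₂ ∷ xs) a≢b
      a-merged (inj₂ refl) = trans (before-skip a b (v₂ ∷ xs) v₁≢v₂ (v≢b refl)) (before-start a b xs a≢b)
    ...   | no σa≢σv₁ =
      trans (before-skip a b {v₁} (v₂ ∷ xs) (v≢ σa≢σv₁ refl) (v≢ σb≢σv₁ refl))
            (trans (before-skip a b {v₂} xs (v≢ σa≢σv₁ σ-v₂) (v≢ σb≢σv₁ σ-v₂))
                   (trans rest (sym (before-skip (σ a) (σ b) ys (σa≢σv₁ ∘ sym) (σb≢σv₁ ∘ sym)))))
      where
      v≢ : ∀ {v c} → σ c ≢ σ v₁ → σ v ≡ σ v₁ → v ≢ c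
      v≢ σc≢σv₁ σv≡σv₁ v≡c = σc≢σv₁ (trans (cong σ (sym v≡c)) σv≡σv₁)

    before-avoiding : ∀ u → v₁ ∉ u → v₂ ∉ u → before a b u ≡ before (σ a) (σ b) (map σ u)
    before-avoiding []      _     _     = refl
    before-avoiding (x ∷ u) v₁∉xu v₂∉xu =
      before-step u (map σ u) (≢-sym (v₁∉xu ∘ here)) (≢-sym (v₂∉xu ∘ here))
                  (before-avoiding u (v₁∉xu ∘ there) (v₂∉xu ∘ there))

    before-insertV₂ : ∀ u → Unique u → v₂ ∉ u → before a b (insertV₂ u) ≡ before (σ a) (σ b) (map σ u)
    before-insertV₂ []      _                _     = refl
    before-insertV₂ (c ∷ u) (c∉u ∷ u-unique) v₂∉cu with c ≟ᶠ v₁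
    ... | yes refl = before-pair u (map σ u) (before-avoiding u (All¬⇒¬Any c∉u) (v₂∉cu ∘ there))
    ... | no c≢v₁  = before-step (insertV₂ u) (map σ u) c≢v₁ (≢-sym (v₂∉cu ∘ here))
                                 (before-insertV₂ u u-unique (v₂∉cu ∘ there))

  before-e-insertV₂ : ∀ u → v₁ ∈ u → v₂ ∉ u → before v₁ v₂ (insertV₂ u) ≡ true
  before-e-insertV₂ (c ∷ u) v₁∈cu v₂∉cu with c ≟ᶠ v₁
  ... | yes refl = before-start v₁ v₂ (v₂ ∷ u) v₁≢v₂
  ... | no c≢v₁  = trans (before-skip v₁ v₂ (insertV₂ u) c≢v₁ (≢-sym (v₂∉cu ∘ here)))
                         (before-e-insertV₂ u (tail (c≢v₁ ∘ sym) v₁∈cu) (v₂∉cu ∘ there))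

  G/e : Graph n
  G/e = contract G i v₁≢v₂

  isLinExt-split : ∀ w → isLinExt G w ≡ before v₁ v₂ w ∧ allᵇ (λ f → before (α f) (ω f) w) others
  isLinExt-split w = allᵇ-removeAt (λ f → before (α f) (ω f) w) (edges G) i

  isLinExt-G/e : ∀ z → isLinExt G/e z ≡ allᵇ (λ f → before (σ (α f)) (σ (ω f)) z) others
  isLinExt-G/e z = allᵇ-map (λ f → before (α f) (ω f) z) (λ f → (σ (α f) , σ (ω f))) others

  isLinExt-insertV₂ : All (λ f → σ (α f) ≢ σ (ω f)) others → ∀ u → Unique u → v₂ ∉ u → v₁ ∈ u →
                      isLinExt G (insertV₂ u) ≡ isLinExt G/e (map σ u)
  isLinExt-insertV₂ no-loops u u-unique v₂∉u v₁∈u = begin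
    isLinExt G (insertV₂ u)
      ≡⟨ isLinExt-split (insertV₂ u) ⟩
    before v₁ v₂ (insertV₂ u) ∧ allᵇ (λ f → before (α f) (ω f) (insertV₂ u)) others
      ≡⟨ cong₂ _∧_ (before-e-insertV₂ u v₁∈u v₂∉u)
                   (allᵇ-cong-All (All.map (λ σf-distinct → before-insertV₂ σf-distinct u u-unique v₂∉u) no-loops)) ⟩
    allᵇ (λ f → before (σ (α f)) (σ (ω f)) (map σ u)) others
      ≡⟨ sym (isLinExt-G/e (map σ u)) ⟩
    isLinExt G/e (map σ u) ∎
    where open ≡-Reasoning

  module Limits (y : Fin n → ℚ) where

    yσ : Fin (suc n) → ℚ
    yσ = y ∘ σ

    -- The limit of (x_{v₁} - x_{v₂}) · wordTerm x w as x tends to y ∘ σ: the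
    -- factor of e survives only by cancelling against an adjacent pair v₁ v₂.
    contribution : List (Fin (suc n)) → ℚ
    contribution w = if adjacent w then wordTerm yσ (deleteV₂ w) else 0ℚ

    Y : ℚ
    Y = prodℚ (map (λ f → yσ (α f) - yσ (ω f)) others)

    edgeProduct-G/e : edgeProduct G/e y ≡ Y
    edgeProduct-G/e = cong prodℚ (sym (map-∘ others))

    limit : List (Fin (suc n)) → ℚ
    limit w = if isLinExt G w then contribution w * Y else 0ℚ

    termG/e : List (Fin n) → ℚ
    termG/e z = if isLinExt G/e z then wordTerm y z * Y else 0ℚ

    L : List (Fin (suc n))
    L = tabulate (punchIn v₂)

    L-unique : Unique L
    L-unique = tabulate⁺ (punchIn-injective v₂ _ _)

    v₂∉L : v₂ ∉ L
    v₂∉L v₂∈L with ∈-tabulate⁻ v₂∈L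
    ... | j , v₂≡punchIn = punchInᵢ≢i v₂ j (sym v₂≡punchIn)

    v₁∈L : v₁ ∈ L
    v₁∈L = subst (_∈ L) (punchIn-punchOut v₂≢v₁) (∈-tabulate⁺ (punchOut v₂≢v₁))

    σL≡allFin : map σ L ≡ allFin n
    σL≡allFin = trans (map-tabulate (punchIn v₂) σ) (tabulate-cong σ-punchIn)

    insertion-sum : All (λ f → σ (α f) ≢ σ (ω f)) others → ∀ u → u ↭ L →
                    ∑ (insertions v₂ u) limit ≡ termG/e (map σ u)
    insertion-sum no-loops u u↭L = begin
      ∑ (insertions v₂ u) limit
        ≡⟨ ∑-cong (insertions v₂ u) (λ w → guard-swap (isLinExt G w) (adjacent w) _ Y) ⟩
      ∑ (insertions v₂ u) (λ w → if adjacent w then H w else 0ℚ)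
        ≡⟨ sym (∑-filter adjacent (insertions v₂ u) H) ⟩
      ∑ (filterᵇ adjacent (insertions v₂ u)) H
        ≡⟨ cong (λ ws → ∑ ws H) (adjacent-insertions u u-unique v₂∉u v₁∈u) ⟩
      H (insertV₂ u) + 0ℚ
        ≡⟨ +-identityʳ _ ⟩
      H (insertV₂ u)
        ≡⟨ cong₂ (λ l z → if l then wordTerm yσ z * Y else 0ℚ) (isLinExt-insertV₂ no-loops u u-unique v₂∉u v₁∈u)
                 (deleteV₂-insertV₂ u v₂∉u) ⟩
      (if isLinExt G/e (map σ u) then wordTerm yσ u * Y else 0ℚ)
        ≡⟨ cong (λ c → if isLinExt G/e (map σ u) then c * Y else 0ℚ) (wordTerm-map y σ u) ⟩
      termG/e (map σ u) ∎
      where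
      open ≡-Reasoning
      H : List (Fin (suc n)) → ℚ
      H w = if isLinExt G w then wordTerm yσ (deleteV₂ w) * Y else 0ℚ
      u-unique : Unique u
      u-unique = unique-↭ (↭-sym u↭L) L-unique
      v₂∉u : v₂ ∉ u
      v₂∉u = v₂∉L ∘ ∈-resp-↭ u↭L
      v₁∈u : v₁ ∈ u
      v₁∈u = ∈-resp-↭ (↭-sym u↭L) v₁∈L

    Nval-G/e : Nval G/e y ≡ ∑ (perms (allFin n)) termG/e
    Nval-G/e = trans (Nval-as-sum G/e y)
      (∑-cong (perms (allFin n)) (λ z → cong (λ c → if isLinExt G/e z then wordTerm y z * c else 0ℚ) edgeProduct-G/e))

    -- If σ collapses another edge, Y = 0 and both sides below vanish; otherwise
    -- regroup the orderings of the vertices of G by their restriction u to L.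
    limits-sum : ∑ (perms (allFin (suc n))) limit ≡ Nval G/e y
    limits-sum with Y ≟ℚ 0ℚ
    ... | yes Y≡0 = begin
      ∑ (perms (allFin (suc n))) limit       ≡⟨ ∑-cong (perms (allFin (suc n))) limit≡0 ⟩
      ∑ (perms (allFin (suc n))) (λ _ → 0ℚ)  ≡⟨ ∑-zero (perms (allFin (suc n))) ⟩
      0ℚ                                     ≡⟨ sym (*-zeroʳ (Ψ G/e y)) ⟩
      Ψ G/e y * 0ℚ                           ≡⟨ cong (Ψ G/e y *_) (sym (trans edgeProduct-G/e Y≡0)) ⟩
      Nval G/e y                             ∎
      where
      open ≡-Reasoning
      limit≡0 : ∀ w → limit w ≡ 0ℚ
      limit≡0 w with isLinExt G w
      ... | true  = trans (cong (contribution w *_) Y≡0) (*-zeroʳ (contribution w))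
      ... | false = refl
    ... | no Y≢0 = begin
      ∑ (perms (allFin (suc n))) limit                ≡⟨ ∑perms-↭ (tabulate-↭ id v₂) limit ⟩
      ∑ (perms (v₂ ∷ L)) limit                        ≡⟨ ∑perms-cons v₂ L limit ⟩
      ∑ (perms L) (λ u → ∑ (insertions v₂ u) limit)   ≡⟨ ∑-cong-All (All.map (insertion-sum no-loops _) (perms-↭ L)) ⟩
      ∑ (perms L) (termG/e ∘ map σ)                   ≡⟨ sym (∑perms-map σ L termG/e) ⟩
      ∑ (perms (map σ L)) termG/e                     ≡⟨ cong (λ l → ∑ (perms l) termG/e) σL≡allFin ⟩
      ∑ (perms (allFin n)) termG/e                    ≡⟨ sym Nval-G/e ⟩
      Nval G/e y                                      ∎
      where
      open ≡-Reasoning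
      no-loops : All (λ f → σ (α f) ≢ σ (ω f)) others
      no-loops = All.map (λ {f} factor≢0 σα≡σω → factor≢0 (trans (cong (λ z → y z - yσ (ω f)) σα≡σω) (sub-self (yσ (ω f)))))
                         (prodℚ-nonzero (λ f → yσ (α f) - yσ (ω f)) others Y≢0)

  -- For injective y, move only the coordinate of v₂ along a
  -- line `point t` with point x₁ = y ∘ σ.  Off the finite set B of coordinates of
  -- y the point is injective, so N(G) is defined there; its terms are regular at
  -- x₁ with the limits computed above.

  module Line (y : Fin n → ℚ) (y-injective : Injective _≡_ _≡_ y) where
    open Limits y

    x₁ : ℚ
    x₁ = yσ v₁

    B : List ℚ
    B = tabulate y

    open Regularity x₁ B

    coordinate : ℚ → (k : Fin (suc n)) → Dec (k ≡ v₂) → ℚ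
    coordinate t k (yes _) = t
    coordinate t k (no _)  = yσ k

    point : ℚ → Fin (suc n) → ℚ
    point t k = coordinate t k (k ≟ᶠ v₂)

    point-x₁ : ∀ k → point x₁ k ≡ yσ k
    point-x₁ k = at-x₁ (k ≟ᶠ v₂)
      where
      at-x₁ : (d : Dec (k ≡ v₂)) → coordinate x₁ k d ≡ yσ k
      at-x₁ (yes refl) = cong y (sym σ-v₂)
      at-x₁ (no _)     = refl

    off-B : ∀ {t} → t ∉ B → ∀ j → y j ≢ t
    off-B t∉B j yj≡t = t∉B (subst (_∈ B) yj≡t (∈-tabulate⁺ j))

    point-injective : ∀ {t} → t ∉ B → Injective _≡_ _≡_ (point t)
    point-injective {t} t∉B {a} {b} = by-cases (a ≟ᶠ v₂) (b ≟ᶠ v₂)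
      where
      by-cases : (da : Dec (a ≡ v₂)) (db : Dec (b ≡ v₂)) → coordinate t a da ≡ coordinate t b db → a ≡ b
      by-cases (yes a≡v₂) (yes b≡v₂) _       = trans a≡v₂ (sym b≡v₂)
      by-cases (yes _)    (no _)     t≡yσb   = ⊥-elim (off-B t∉B (σ b) (sym t≡yσb))
      by-cases (no _)     (yes _)    yσa≡t   = ⊥-elim (off-B t∉B (σ a) yσa≡t)
      by-cases (no a≢v₂)  (no b≢v₂)  yσa≡yσb = σ-injective a≢v₂ b≢v₂ (y-injective yσa≡yσb)

    coordinateU : (k : Fin (suc n)) → Dec (k ≡ v₂) → UPoly
    coordinateU k (yes _) = varU
    coordinateU k (no _)  = constU (yσ k)

    coordU : Fin (suc n) → UPoly
    coordU k = coordinateU k (k ≟ᶠ v₂)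

    evalU-coord : ∀ k t → evalU (coordU k) t ≡ point t k
    evalU-coord k t = by-cases (k ≟ᶠ v₂)
      where
      by-cases : (d : Dec (k ≡ v₂)) → evalU (coordinateU k d) t ≡ coordinate t k d
      by-cases (yes _) = evalU-var t
      by-cases (no _)  = evalU-const (yσ k) t

    restrict : Poly (suc n) → UPoly
    restrict (var k) = coordU k
    restrict (con c) = constU c
    restrict (P ⊕ Q) = addU (restrict P) (restrict Q)
    restrict (P ⊗ Q) = mulU (restrict P) (restrict Q)
    restrict (⊝ P)   = scaleU (- 1ℚ) (restrict P)

    evalU-restrict : ∀ P t → evalU (restrict P) t ≡ eval P (point t)
    evalU-restrict (var k) t = evalU-coord k t
    evalU-restrict (con c) t = evalU-const c t
    evalU-restrict (P ⊕ Q) t = trans (evalU-add (restrict P) (restrict Q) t) (cong₂ _+_ (evalU-restrict P t) (evalU-restrict Q t))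
    evalU-restrict (P ⊗ Q) t = trans (evalU-mul (restrict P) (restrict Q) t) (cong₂ _*_ (evalU-restrict P t) (evalU-restrict Q t))
    evalU-restrict (⊝ P)   t = trans (evalU-scale (- 1ℚ) (restrict P) t)
      (trans (cong (- 1ℚ *_) (evalU-restrict P t)) (solve 1 (λ x → κ (- 1ℚ) :* x := :- x) refl (eval P (point t))))

    diffU : Fin (suc n) → Fin (suc n) → UPoly
    diffU a b = subU (coordU a) (coordU b)

    evalU-diff : ∀ a b t → evalU (diffU a b) t ≡ point t a - point t b
    evalU-diff a b t = trans (evalU-sub (coordU a) (coordU b) t) (cong₂ _-_ (evalU-coord a t) (evalU-coord b t))

    diff-x₁ : ∀ a b → evalU (diffU a b) x₁ ≡ yσ a - yσ b
    diff-x₁ a b = trans (evalU-diff a b x₁) (cong₂ _-_ (point-x₁ a) (point-x₁ b))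

    regular-diff : ∀ a b → Regular (λ t → point t a - point t b) (yσ a - yσ b)
    regular-diff a b = regular-ext (λ t _ → evalU-diff a b t) (diff-x₁ a b) (regular-poly (diffU a b))

    regular-inv-diff : ∀ {a b} → a ≢ b → σ a ≢ σ b → Regular (λ t → inv (point t a - point t b)) (inv (yσ a - yσ b))
    regular-inv-diff {a} {b} a≢b σa≢σb =
      regular-ext (λ t _ → cong inv (evalU-diff a b t)) (cong inv (diff-x₁ a b)) (regular-inv (diffU a b) nonzero-off nonzero-x₁)
      where
      nonzero-off : ∀ t → t ∉ B → evalU (diffU a b) t ≢ 0ℚ
      nonzero-off t t∉B = subst (_≢ 0ℚ) (sym (evalU-diff a b t)) (sub-nonzero (a≢b ∘ point-injective t∉B))
      nonzero-x₁ : evalU (diffU a b) x₁ ≢ 0ℚ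
      nonzero-x₁ = subst (_≢ 0ℚ) (sym (diff-x₁ a b)) (sub-nonzero (σa≢σb ∘ y-injective))

    -- A word avoiding v₁ has no factor that degenerates at x₁.
    regular-word : ∀ w → Unique w → v₁ ∉ w → Regular (λ t → wordTerm (point t) w) (wordTerm yσ w)
    regular-word []          _                           _      = regular-const 1ℚ
    regular-word (a ∷ [])    _                           _      = regular-const 1ℚ
    regular-word (a ∷ b ∷ r) ((a≢b ∷ _) ∷ br-unique) v₁∉abr =
      regular-* (regular-inv-diff a≢b (σ-separates a≢b (λ (a≡v₁ , _) → v₁∉abr (here (sym a≡v₁)))
                                                       (λ (_ , b≡v₁) → v₁∉abr (there (here (sym b≡v₁))))))
                (regular-word (b ∷ r) br-unique (v₁∉abr ∘ there))

    E : ℚ → ℚ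
    E t = point t v₁ - point t v₂

    E-nonzero : ∀ {t} → t ∉ B → E t ≢ 0ℚ
    E-nonzero t∉B = sub-nonzero (v₁≢v₂ ∘ point-injective t∉B)

    E-x₁ : yσ v₁ - yσ v₂ ≡ 0ℚ
    E-x₁ = trans (cong (λ z → yσ v₁ - y z) σ-v₂) (sub-self (yσ v₁))

    contribution-cons : ∀ {a b} r → a ≢ v₁ → a ≢ v₂ → b ≢ v₂ →
                        contribution (a ∷ b ∷ r) ≡ inv (yσ a - yσ b) * contribution (b ∷ r)
    contribution-cons {a} {b} r a≢v₁ a≢v₂ b≢v₂
      rewrite adjacent-cons (b ∷ r) a≢v₁ | deleteV₂-keep (b ∷ r) a≢v₂ | deleteV₂-keep r b≢v₂
      with adjacent (b ∷ r)
    ... | true  = refl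
    ... | false = sym (*-zeroʳ (inv (yσ a - yσ b)))

    edge-short : Regular (λ t → E t * 1ℚ) 0ℚ
    edge-short = regular-ext (λ t _ → refl) (trans (*-identityʳ _) E-x₁)
                             (regular-* (regular-diff v₁ v₂) (regular-const 1ℚ))

    -- w = v₁ v₂ r: E cancels the first factor 1/(x_{v₁} - x_{v₂}) of wordTerm.
    edge-pair : ∀ r → Unique (v₁ ∷ v₂ ∷ r) →
                Regular (λ t → E t * wordTerm (point t) (v₁ ∷ v₂ ∷ r)) (contribution (v₁ ∷ v₂ ∷ r))
    edge-pair r (v₁∉v₂r ∷ v₂r-unique) =
      regular-ext (λ t t∉B → sym (inv-cancel (E t) (wordTerm (point t) (v₂ ∷ r)) (E-nonzero t∉B))) limit-value
                  (regular-word (v₂ ∷ r) v₂r-unique (All¬⇒¬Any v₁∉v₂r))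
      where
      v₂∉r : v₂ ∉ r
      v₂∉r = unique-head v₂r-unique
      limit-value : wordTerm yσ (v₂ ∷ r) ≡ contribution (v₁ ∷ v₂ ∷ r)
      limit-value rewrite adjacent-hit r | deleteV₂-pair r v₂∉r = wordTerm-head yσ r (cong y σ-v₂)

    -- w = v₁ b r with b ≠ v₂: E survives and tends to 0.
    edge-broken : ∀ {b} r → b ≢ v₂ → Unique (v₁ ∷ b ∷ r) →
                  Regular (λ t → E t * wordTerm (point t) (v₁ ∷ b ∷ r)) (contribution (v₁ ∷ b ∷ r))
    edge-broken {b} r b≢v₂ (v₁∉br ∷ br-unique) =
      regular-ext (λ t _ → *-swap (inv (point t v₁ - point t b)) (E t) _) limit-value
        (regular-* (regular-inv-diff v₁≢b (σ-separates v₁≢b (b≢v₂ ∘ proj₂) (v₁≢v₂ ∘ proj₁)))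
                   (regular-* (regular-diff v₁ v₂) (regular-word (b ∷ r) br-unique (All¬⇒¬Any v₁∉br))))
      where
      v₁≢b : v₁ ≢ b
      v₁≢b = All.head v₁∉br
      not-adjacent : adjacent (v₁ ∷ b ∷ r) ≡ false
      not-adjacent = trans (adjacent-skip v₁ r b≢v₂) (adjacent-without-v₁ (b ∷ r) (All¬⇒¬Any v₁∉br))
      limit-value : inv (yσ v₁ - yσ b) * ((yσ v₁ - yσ v₂) * wordTerm yσ (b ∷ r)) ≡ contribution (v₁ ∷ b ∷ r)
      limit-value rewrite E-x₁ | not-adjacent =
        trans (cong (inv (yσ v₁ - yσ b) *_) (*-zeroˡ (wordTerm yσ (b ∷ r)))) (*-zeroʳ (inv (yσ v₁ - yσ b)))

    edge-later : ∀ {a b} r → a ≢ v₁ → a ≢ v₂ → b ≢ v₂ → Unique (a ∷ b ∷ r) →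
                 Regular (λ t → E t * wordTerm (point t) (b ∷ r)) (contribution (b ∷ r)) →
                 Regular (λ t → E t * wordTerm (point t) (a ∷ b ∷ r)) (contribution (a ∷ b ∷ r))
    edge-later {a} {b} r a≢v₁ a≢v₂ b≢v₂ ((a≢b ∷ _) ∷ _) regular-rest =
      regular-ext (λ t _ → *-swap (inv (point t a - point t b)) (E t) _) (sym (contribution-cons r a≢v₁ a≢v₂ b≢v₂))
        (regular-* (regular-inv-diff a≢b (σ-separates a≢b (a≢v₁ ∘ proj₁) (a≢v₂ ∘ proj₁))) regular-rest)

    regular-edge-word : ∀ w → Unique w → before v₂ v₁ w ≡ false →
                        Regular (λ t → E t * wordTerm (point t) w) (contribution w)
    regular-edge-word []          _        _        = edge-short
    regular-edge-word (a ∷ [])    _        _        = edge-short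
    regular-edge-word (a ∷ b ∷ r) w-unique@(_ ∷ br-unique) v₁-first = by-cases (a ≟ᶠ v₁) (b ≟ᶠ v₂)
      where
      not-v₂-first : ∀ {c} r′ → c ≡ v₂ → before v₂ v₁ (c ∷ r′) ≢ false
      not-v₂-first r′ refl v₂-first with trans (sym (before-start v₂ v₁ r′ v₂≢v₁)) v₂-first
      ... | ()
      by-cases : Dec (a ≡ v₁) → Dec (b ≡ v₂) →
                 Regular (λ t → E t * wordTerm (point t) (a ∷ b ∷ r)) (contribution (a ∷ b ∷ r))
      by-cases (yes refl) (yes refl) = edge-pair r w-unique
      by-cases (yes refl) (no b≢v₂)  = edge-broken r b≢v₂ w-unique
      by-cases (no a≢v₁)  _          =
        edge-later r a≢v₁ a≢v₂ b≢v₂ w-unique (regular-edge-word (b ∷ r) br-unique v₁-first′)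
        where
        a≢v₂ : a ≢ v₂
        a≢v₂ a≡v₂ = not-v₂-first (b ∷ r) a≡v₂ v₁-first
        v₁-first′ : before v₂ v₁ (b ∷ r) ≡ false
        v₁-first′ = trans (sym (before-skip v₂ v₁ (b ∷ r) a≢v₂ a≢v₁)) v₁-first
        b≢v₂ : b ≢ v₂
        b≢v₂ b≡v₂ = not-v₂-first r b≡v₂ v₁-first′

    Π : ℚ → ℚ
    Π t = prodℚ (map (λ f → point t (α f) - point t (ω f)) others)

    regular-Π : Regular Π Y
    regular-Π = regular-prod others (λ f t → point t (α f) - point t (ω f)) (λ f → yσ (α f) - yσ (ω f))
                  (All.tabulate (λ {f} _ → regular-diff (α f) (ω f)))

    term : List (Fin (suc n)) → ℚ → ℚ
    term w t = if isLinExt G w then (E t * wordTerm (point t) w) * Π t else 0ℚ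

    Nval-line : ∀ t → Nval G (point t) ≡ ∑ (perms (allFin (suc n))) (λ w → term w t)
    Nval-line t = trans (Nval-as-sum G (point t)) (∑-cong (perms (allFin (suc n))) regroup)
      where
      edgeProduct-line : edgeProduct G (point t) ≡ E t * Π t
      edgeProduct-line = prodℚ-removeAt (λ f → point t (α f) - point t (ω f)) (edges G) i
      regroup : ∀ w → (if isLinExt G w then wordTerm (point t) w * edgeProduct G (point t) else 0ℚ) ≡ term w t
      regroup w = cong (if isLinExt G w then_else 0ℚ) (begin
        wordTerm (point t) w * edgeProduct G (point t) ≡⟨ cong (wordTerm (point t) w *_) edgeProduct-line ⟩
        wordTerm (point t) w * (E t * Π t)             ≡⟨ solve 3 (λ W e p → W :* (e :* p) := e :* W :* p) refl _ (E t) (Π t) ⟩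
        (E t * wordTerm (point t) w) * Π t             ∎)
        where open ≡-Reasoning

    regular-term : ∀ w → w ↭ allFin (suc n) → Regular (term w) (limit w)
    regular-term w w↭S with isLinExt G w in linExt
    ... | true  = regular-* (regular-edge-word w (unique-↭ (↭-sym w↭S) (allFin⁺ (suc n))) v₁-first) regular-Π
      where
      v₁-first : before v₂ v₁ w ≡ false
      v₁-first = before-flip v₁ v₂ w (∧-true-left (trans (sym (isLinExt-split w)) linExt))
    ... | false = regular-const 0ℚ

    regular-N : Regular (λ t → Nval G (point t)) (∑ (perms (allFin (suc n))) limit)
    regular-N = regular-ext (λ t _ → sym (Nval-line t)) refl
                  (regular-sum (perms (allFin (suc n))) term limit (All.map (regular-term _) (perms-↭ (allFin (suc n)))))

    value-at-yσ : ∀ P → IsN G P → eval P yσ ≡ ∑ (perms (allFin (suc n))) limit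
    value-at-yσ P P-is-N = begin
      eval P yσ                    ≡⟨ eval-cong P (sym ∘ point-x₁) ⟩
      eval P (point x₁)            ≡⟨ sym (evalU-restrict P x₁) ⟩
      evalU (restrict P) x₁        ≡⟨ regular-unique regular-N (restrict P) P≡N-off-B ⟩
      ∑ (perms (allFin (suc n))) limit ∎
      where
      open ≡-Reasoning
      P≡N-off-B : ∀ t → t ∉ B → evalU (restrict P) t ≡ Nval G (point t)
      P≡N-off-B t t∉B = trans (evalU-restrict P t) (P-is-N (point t) (point-injective t∉B))

mainTheorem4 : ∀ {n} (G : Graph (suc n)) (i : Fin (length (edges G)))
                 (ne : α (lookup (edges G) i) ≢ ω (lookup (edges G) i))
                 (P : Poly (suc n)) →
                 IsN G P →
                 IsN (contract G i ne)
                     (rename (merge (α (lookup (edges G) i)) (ω (lookup (edges G) i)) ne) P)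
mainTheorem4 G i ne P P-is-N y y-injective = begin
  eval (rename σ P) y                  ≡⟨ eval-rename σ P y ⟩
  eval P (y ∘ σ)                       ≡⟨ value-at-yσ P P-is-N ⟩
  ∑ (perms (allFin _)) limit           ≡⟨ limits-sum ⟩
  Nval (contract G i ne) y             ∎
  where
  open ≡-Reasoning
  open Contraction G i ne
  open Limits y
  open Line y y-injective
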